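{- Let $G$ be a bipartite dHp graph with sides $A$ and $B$, both infinite and countable, and let $<$ be a linear order on $A$ of order type $\omega$. Let $R=\ldots v_3u_3v_1u_1v_0u_0v_2u_2v_4u_4\ldots$ be a double ray in $G$ with $v_i\in A$ and $u_i\in B$ for all $i\in\mathbb{N}$, which is $<$-economical with starting point $v_0$. Suppose that no vertex of $A$ is pseudo-isolated in $G$. Let $A'=A\setminus\{v_i:i\in\mathbb{N}\}$, $B'=B\setminus\{u_i:i\in\mathbb{N}\}$, and let $G'$ be the subgraph of $G$ induced by $A'\cup B'$. Then no vertex of $A'$ is pseudo-isolated in $G'$.
   Context: For $X\subseteq V(G)$ with $|X|\ge 2$, $N^2(X)$ denotes the set of vertices of $G$ having at least two neighbours in $X$. A bipartite graph $G$ with sides $A$ and $B$ is a dHp graph if $|A|\ge 2$ and $|N^2(X)|\ge |X|$ for every $X\subseteq A$ with $|X|\ge 2$. A vertex $v$ of an infinite graph $K$ is pseudo-isolated in $K$ if there exists a finite set $F\subset V(K)\setminus\{v\}$ such that no vertex $w$ of $K\setminus F$ satisfies $d_{K\setminus F}(v,w)=2$. The double ray $R$ is $<$-economical with starting point $v_0$ if: for every $k\in\mathbb{N}$, $v_{2k+2}$ is the $<$-minimal vertex of $A$ which can be added to the finite path $v_{2k+1}u_{2k+1}\ldots v_1u_1v_0u_0v_2\ldots u_{2k-2}v_{2k}$ on the $v_{2k}$-side (i.e. the $<$-minimal $a\in A$ not on this path for which some $b\in B$ not on this path is adjacent to both $v_{2k}$ and $a$, with $u_{2k}$ such a $b$);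 and for every $k\in\mathbb{N}$, $v_{2k+3}$ is the $<$-minimal vertex of $A$ which can be added to the finite path $v_{2k+1}u_{2k+1}\ldots v_1u_1v_0u_0v_2\ldots v_{2k}u_{2k}v_{2k+2}$ on the $v_{2k+1}$-side (analogously, with $u_{2k+1}$ the connecting vertex of $B$). -}

module Defs where

open import Data.Nat using (ℕ; zero; suc; _+_; _*_; _<_; _≤_)
open import Data.Sum using (_⊎_; inj₁; inj₂)
open import Data.Product using (Σ; Σ-syntax; ∃; ∃-syntax; _×_; _,_; proj₁)
open import Data.Empty using (⊥)
open import Data.Unit using (⊤)
open import Data.List using (List)
open import Data.List.Membership.Propositional using (_∈_; _∉_)
open import Relation.Nullary using (¬_)
open import Relation.Binary.PropositionalEquality using (_≡_; _≢_)
open import Function.Definitions using (Injective; Bijective)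

-- Convention: the two countably infinite sides A and B are both (copies of) ℕ.
-- The bipartite graph G is given by  E a b  ("a ∈ A is adjacent to b ∈ B").
-- Vertex set of G: V = A ⊎ B  (inj₁ = side A, inj₂ = side B).

V : Set
V = ℕ ⊎ ℕ

Adj : (ℕ → ℕ → Set) → V → V → Set
Adj E (inj₁ a) (inj₂ b) = E a b
Adj E (inj₂ b) (inj₁ a) = E a b
Adj E (inj₁ _) (inj₁ _) = ⊥
Adj E (inj₂ _) (inj₂ _) = ⊥

AtLeastTwo : {T : Set} → (T → Set) → Set
AtLeastTwo {T} X = Σ[ x ∈ T ] Σ[ y ∈ T ] (x ≢ y × X x × X y)

_≼_ : {S T : Set} → (S → Set) → (T → Set) → Set
_≼_ {S} {T} X Y =
  Σ[ f ∈ (Σ S X → Σ T Y) ] (∀ p q → proj₁ (f p) ≡ proj₁ (f q) → proj₁ p ≡ proj₁ q)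

N² : (ℕ → ℕ → Set) → (ℕ → Set) → ℕ → Set
N² E X b = Σ[ a₁ ∈ ℕ ] Σ[ a₂ ∈ ℕ ] (a₁ ≢ a₂ × X a₁ × X a₂ × E a₁ b × E a₂ b)

-- dHp graph: |A| ≥ 2 (automatic, A = ℕ) and |N²(X)| ≥ |X| for all X ⊆ A with |X| ≥ 2
IsDHp : (ℕ → ℕ → Set) → Set₁
IsDHp E = (X : ℕ → Set) → AtLeastTwo X → X ≼ N² E X

-- Pseudo-isolated vertex v in the induced subgraph K = G[S] (S ⊆ V):
-- there is a finite F ⊆ V(K) ∖ {v} such that no vertex w of K ∖ F
-- has distance exactly 2 from v in K ∖ F.
Dist2 : (ℕ → ℕ → Set) → (V → Set) → List V → V → V → Set
Dist2 E S F v w =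
  w ≢ v × ¬ Adj E v w ×
  (Σ[ x ∈ V ] (S x × x ∉ F × Adj E v x × Adj E x w))

PseudoIsolated : (ℕ → ℕ → Set) → (V → Set) → V → Set
PseudoIsolated E S v =
  Σ[ F ∈ List V ] ((∀ x → x ∈ F → S x) × v ∉ F ×
    ¬ (Σ[ w ∈ V ] (S w × w ∉ F × Dist2 E S F v w)))

AllV : V → Set
AllV _ = ⊤

-- Linear order < on A of order type ω, given by a bijective rank function:
-- a < b  iff  rk a < rk b.
OrderTypeω : (ℕ → ℕ) → Set
OrderTypeω rk = Bijective _≡_ _≡_ rk

-- The double ray R = … v₃u₃v₁u₁v₀u₀v₂u₂v₄u₄ … with vᵢ ∈ A, uᵢ ∈ B:
-- all vertices distinct and consecutive vertices adjacent, i.e.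
--   u_{2k} ~ v_{2k}, v_{2k+2};  u₁ ~ v₁, v₀;  u_{2k+3} ~ v_{2k+3}, v_{2k+1}.
IsDoubleRay : (ℕ → ℕ → Set) → (ℕ → ℕ) → (ℕ → ℕ) → Set
IsDoubleRay E v u =
  Injective _≡_ _≡_ v × Injective _≡_ _≡_ u ×
  (∀ k → E (v (2 * k)) (u (2 * k))) ×
  (∀ k → E (v (2 * k + 2)) (u (2 * k))) ×
  (∀ k → E (v (2 * k + 1)) (u (2 * k + 1))) ×
  E (v 0) (u 1) ×
  (∀ k → E (v (2 * k + 1)) (u (2 * k + 3)))

-- Vertices of the finite path  v_{2k+1}u_{2k+1}…v₁u₁v₀u₀v₂…u_{2k-2}v_{2k}:
-- A-part {v_j : j ≤ 2k+1},  B-part {u_j : j ≤ 2k+1, j ≠ 2k}.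
OnPathEvenA : (ℕ → ℕ) → ℕ → ℕ → Set
OnPathEvenA v k a = Σ[ j ∈ ℕ ] (j ≤ 2 * k + 1 × v j ≡ a)

OnPathEvenB : (ℕ → ℕ) → ℕ → ℕ → Set
OnPathEvenB u k b = Σ[ j ∈ ℕ ] (j ≤ 2 * k + 1 × j ≢ 2 * k × u j ≡ b)

-- Vertices of the finite path  v_{2k+1}u_{2k+1}…v₁u₁v₀u₀v₂…v_{2k}u_{2k}v_{2k+2}:
-- A-part {v_j : j ≤ 2k+2},  B-part {u_j : j ≤ 2k+1}.
OnPathOddA : (ℕ → ℕ) → ℕ → ℕ → Set
OnPathOddA v k a = Σ[ j ∈ ℕ ] (j ≤ 2 * k + 2 × v j ≡ a)

OnPathOddB : (ℕ → ℕ) → ℕ → ℕ → Set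
OnPathOddB u k b = Σ[ j ∈ ℕ ] (j ≤ 2 * k + 1 × u j ≡ b)

-- a ∈ A can be added to a finite path (vertex sets PA ⊆ A, PB ⊆ B) at end e ∈ A
-- via the connecting vertex b ∈ B
AddableVia : (ℕ → ℕ → Set) → (ℕ → Set) → (ℕ → Set) → ℕ → ℕ → ℕ → Set
AddableVia E PA PB e a b = ¬ PA a × ¬ PB b × E e b × E a b

Addable : (ℕ → ℕ → Set) → (ℕ → Set) → (ℕ → Set) → ℕ → ℕ → Set
Addable E PA PB e a = Σ[ b ∈ ℕ ] AddableVia E PA PB e a b

IsEconomical : (ℕ → ℕ → Set) → (ℕ → ℕ) → (ℕ → ℕ) → (ℕ → ℕ) → Set
IsEconomical E rk v u =
  (∀ k →
    AddableVia E (OnPathEvenA v k) (OnPathEvenB u k) (v (2 * k)) (v (2 * k + 2)) (u (2 * k)) ×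
    (∀ a → Addable E (OnPathEvenA v k) (OnPathEvenB u k) (v (2 * k)) a →
       rk (v (2 * k + 2)) ≤ rk a)) ×
  (∀ k →
    AddableVia E (OnPathOddA v k) (OnPathOddB u k) (v (2 * k + 1)) (v (2 * k + 3)) (u (2 * k + 3)) ×
    (∀ a → Addable E (OnPathOddA v k) (OnPathOddB u k) (v (2 * k + 1)) a →
       rk (v (2 * k + 3)) ≤ rk a))

S' : (ℕ → ℕ) → (ℕ → ℕ) → V → Set
S' v u (inj₁ a) = ∀ i → v i ≢ a
S' v u (inj₂ b) = ∀ i → u i ≢ b

{-# OPTIONS --safe #-}
-- Suppose F witnesses that a ∈ A' is pseudo-isolated in G'. Only finitely many ray
-- vertices vⱼ satisfy vⱼ ≤ a, say all have index j < N (such an N exists only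
-- classically, which suffices for a negative conclusion). Add to F the first 2 + N
-- vertices of each kind on the ray. A path a b a' in G avoiding the enlarged set
-- lies in G': if b = uⱼ or a' = vⱼ with j large, then a could have been attached to
-- the ray at stage j, so economy yields a ray vertex vᵢ ≤ a with i ≥ j ≥ N. Hence a
-- would be pseudo-isolated in G.
module Submission where

open import Defs
open import Data.Nat using (ℕ; zero; suc; _+_; _*_; _<_; _≤_; _⊔_; s≤s; z≤n; _≟_)
open import Data.Nat.Properties
  using (*-suc; ≤-reflexive; ≤-<-trans; ≤⇒≯; m≤m+n; m≤n⇒m≤o+n; +-monoʳ-≤; +-monoʳ-<;
         m<1+n⇒m<n∨m≡n; m<n⇒m<n⊔o; m<n⇒m<o⊔n)
open import Data.Nat.Tactic.RingSolver using (solve-∀)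
open import Data.Sum using (inj₁; inj₂; [_,_]′)
open import Data.Sum.Properties using (inj₁-injective)
open import Data.Product using (_×_; _,_; proj₁; proj₂; ∃-syntax; Σ-syntax)
open import Data.Unit using (tt)
open import Data.List using (List; _++_; applyUpTo)
open import Data.List.Membership.Propositional using (_∈_; _∉_)
open import Data.List.Membership.Propositional.Properties
  using (∈-++⁺ˡ; ∈-++⁺ʳ; ∈-++⁻; ∈-applyUpTo⁺; ∈-applyUpTo⁻)
open import Effect.Monad using (RawMonad)
open import Function using (_∘_)
open import Level using (0ℓ)
open import Function.Definitions using (Injective)
open import Relation.Nullary using (¬_; Dec; yes; no; contradiction)
open import Relation.Nullary.Decidable using (¬¬-excluded-middle)
open import Relation.Nullary.Negation using (¬¬-Monad)
open import Relation.Binary.PropositionalEquality using (_≡_; _≢_; refl; sym; trans; cong; subst)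

data EvenOrOdd : ℕ → Set where
  even : ∀ k → EvenOrOdd (2 * k)
  odd  : ∀ k → EvenOrOdd (2 * k + 1)

evenOrOdd : ∀ n → EvenOrOdd n
evenOrOdd 0 = even 0
evenOrOdd 1 = odd 0
evenOrOdd (suc (suc n)) with evenOrOdd n
... | even k = subst EvenOrOdd (*-suc 2 k) (even (suc k))
... | odd k  = subst EvenOrOdd (cong (_+ 1) (*-suc 2 k)) (odd (suc k))

2[1+k]+1≡2k+3 : ∀ k → 2 * suc k + 1 ≡ 2 * k + 3
2[1+k]+1≡2k+3 = solve-∀

open RawMonad (¬¬-Monad {0ℓ}) using (return; _>>=_)

¬¬-preimage-<-bounded : {f : ℕ → ℕ} → Injective _≡_ _≡_ f →
                        ∀ r → ¬ ¬ (∃[ N ] ∀ {j} → f j < r → j < N)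
¬¬-preimage-<-bounded f-inj zero = return (0 , λ ())
¬¬-preimage-<-bounded {f} f-inj (suc r) = do
  (N , bounded) ← ¬¬-preimage-<-bounded f-inj r
  hit? ← ¬¬-excluded-middle {A = ∃[ i ] f i ≡ r}
  return (extend N bounded hit?)
  where
  extend : ∀ N → (∀ {j} → f j < r → j < N) → Dec (∃[ i ] f i ≡ r) →
           ∃[ M ] ∀ {j} → f j < suc r → j < M
  extend N bounded (yes (i , fi≡r)) = N ⊔ suc i , λ fj≤r →
    [ m<n⇒m<n⊔o (suc i) ∘ bounded
    , (λ fj≡r → m<n⇒m<o⊔n N (s≤s (≤-reflexive (f-inj (trans fj≡r (sym fi≡r))))))
    ]′ (m<1+n⇒m<n∨m≡n fj≤r)
  extend N bounded (no no-hit) = N , λ {j} fj≤r →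
    [ bounded
    , (λ fj≡r → contradiction (j , fj≡r) no-hit)
    ]′ (m<1+n⇒m<n∨m≡n fj≤r)

rayPrefix : (ℕ → ℕ) → (ℕ → ℕ) → ℕ → List V
rayPrefix v u m = applyUpTo (inj₁ ∘ v) m ++ applyUpTo (inj₂ ∘ u) m

module RayPrefix (v u : ℕ → ℕ) (m : ℕ) where

  v∈rayPrefix : ∀ {i} → i < m → inj₁ (v i) ∈ rayPrefix v u m
  v∈rayPrefix = ∈-++⁺ˡ ∘ ∈-applyUpTo⁺ (inj₁ ∘ v)

  u∈rayPrefix : ∀ {i} → i < m → inj₂ (u i) ∈ rayPrefix v u m
  u∈rayPrefix = ∈-++⁺ʳ _ ∘ ∈-applyUpTo⁺ (inj₂ ∘ u)

  A'∉rayPrefix : ∀ {a} → S' v u (inj₁ a) → inj₁ a ∉ rayPrefix v u m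
  A'∉rayPrefix a∈A' a∈P with ∈-++⁻ (applyUpTo (inj₁ ∘ v) m) a∈P
  ... | inj₁ a∈vs with i , _ , eq ← ∈-applyUpTo⁻ (inj₁ ∘ v) a∈vs = a∈A' i (sym (inj₁-injective eq))
  ... | inj₂ a∈us with _ , _ , () ← ∈-applyUpTo⁻ (inj₂ ∘ u) a∈us

module EconomicalRay {E : ℕ → ℕ → Set} {rk v u : ℕ → ℕ}
                     (ray : IsDoubleRay E v u) (economical : IsEconomical E rk v u) where

  private
    u-injective : Injective _≡_ _≡_ u
    u-injective = proj₁ (proj₂ ray)

    v₂ₖ~u₂ₖ : ∀ k → E (v (2 * k)) (u (2 * k))
    v₂ₖ~u₂ₖ = proj₁ (proj₂ (proj₂ ray))

    v₂ₖ₊₁~u₂ₖ₊₃ : ∀ k → E (v (2 * k + 1)) (u (2 * k + 3))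
    v₂ₖ₊₁~u₂ₖ₊₃ = proj₂ (proj₂ (proj₂ (proj₂ (proj₂ (proj₂ ray)))))

    even-minimal : ∀ k {a} → Addable E (OnPathEvenA v k) (OnPathEvenB u k) (v (2 * k)) a →
                   rk (v (2 * k + 2)) ≤ rk a
    even-minimal k = proj₂ (proj₁ economical k) _

    odd-minimal : ∀ k {a} → Addable E (OnPathOddA v k) (OnPathOddB u k) (v (2 * k + 1)) a →
                  rk (v (2 * k + 3)) ≤ rk a
    odd-minimal k = proj₂ (proj₂ economical k) _

  RayVertexBelow : ℕ → ℕ → Set
  RayVertexBelow a j = ∃[ i ] j ≤ i × rk (v i) ≤ rk a

  common-B'-neighbour⇒ray-vertex-below : ∀ {a b i} → S' v u (inj₁ a) → S' v u (inj₂ b) →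
                                          E (v i) b → E a b → RayVertexBelow a i
  common-B'-neighbour⇒ray-vertex-below {a} {b} {i} a∈A' b∈B' evb eab with evenOrOdd i
  ... | even k = 2 * k + 2 , m≤m+n (2 * k) 2
      , even-minimal k (b , (λ (j , _ , e) → a∈A' j e) , (λ (j , _ , _ , e) → b∈B' j e) , evb , eab)
  ... | odd k = 2 * k + 3 , +-monoʳ-≤ (2 * k) (s≤s z≤n)
      , odd-minimal k (b , (λ (j , _ , e) → a∈A' j e) , (λ (j , _ , e) → b∈B' j e) , evb , eab)

  neighbour-on-ray⇒ray-vertex-below : ∀ {a j} → S' v u (inj₁ a) → j ≢ 1 →
                                       E a (u j) → RayVertexBelow a j
  neighbour-on-ray⇒ray-vertex-below {a} {j} a∈A' j≢1 eau with evenOrOdd j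
  ... | even k = 2 * k + 2 , m≤m+n (2 * k) 2
      , even-minimal k (u (2 * k) , (λ (i , _ , e) → a∈A' i e)
          , (λ (i , _ , i≢2k , e) → i≢2k (u-injective e)) , v₂ₖ~u₂ₖ k , eau)
  ... | odd zero = contradiction refl j≢1
  ... | odd (suc k) = 2 * k + 3 , ≤-reflexive (2[1+k]+1≡2k+3 k)
      , odd-minimal k (u (2 * k + 3) , (λ (i , _ , e) → a∈A' i e)
          , (λ (i , i≤2k+1 , e) → ≤⇒≯ (subst (_≤ 2 * k + 1) (u-injective e) i≤2k+1)
                                       (+-monoʳ-< (2 * k) (s≤s (s≤s z≤n))))
          , v₂ₖ₊₁~u₂ₖ₊₃ k , subst (E a ∘ u) (2[1+k]+1≡2k+3 k) eau)

  pseudo-isolated-in-G'⇒G : ∀ {a} N → S' v u (inj₁ a) → (∀ {j} → rk (v j) < suc (rk a) → j < N) →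
                            PseudoIsolated E (S' v u) (inj₁ a) → PseudoIsolated E AllV (inj₁ a)
  pseudo-isolated-in-G'⇒G {a} N a∈A' below⇒<N (F , _ , a∉F , isolated') =
    F ++ P , (λ _ _ → tt) , [ a∉F , a∉P ]′ ∘ ∈-++⁻ F , isolated
    where
    -- u₁ lies on every initial path of the ray, so economy says nothing about it;
    -- the prefix length 2 + N covers it.
    P : List V
    P = rayPrefix v u (2 + N)

    open RayPrefix v u (2 + N)

    a∉P : inj₁ a ∉ P
    a∉P = A'∉rayPrefix a∈A'

    ray-vertex-below⇒<N : ∀ {j} → RayVertexBelow a j → j < N
    ray-vertex-below⇒<N (i , j≤i , vi≤a) = ≤-<-trans j≤i (below⇒<N (s≤s vi≤a))

    neighbour∈B' : ∀ {b} → E a b → inj₂ b ∉ P → S' v u (inj₂ b)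
    neighbour∈B' eab b∉P j refl with j ≟ 1
    ... | yes refl = b∉P (u∈rayPrefix (s≤s (s≤s z≤n)))
    ... | no j≢1   = b∉P (u∈rayPrefix (m≤n⇒m≤o+n 2
                       (ray-vertex-below⇒<N (neighbour-on-ray⇒ray-vertex-below a∈A' j≢1 eab))))

    second-neighbour∈A' : ∀ {a' b} → E a b → S' v u (inj₂ b) → E a' b → inj₁ a' ∉ P → S' v u (inj₁ a')
    second-neighbour∈A' eab b∈B' ea'b a'∉P i refl = a'∉P (v∈rayPrefix (m≤n⇒m≤o+n 2
      (ray-vertex-below⇒<N (common-B'-neighbour⇒ray-vertex-below a∈A' b∈B' ea'b eab))))

    isolated : ¬ (Σ[ w ∈ V ] (AllV w × w ∉ F ++ P × Dist2 E AllV (F ++ P) (inj₁ a) w))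
    isolated (inj₁ a' , _ , a'∉F++P , a'≢a , a≁a' , inj₂ b , _ , b∉F++P , eab , ea'b) =
      isolated' (inj₁ a' , a'∈A' , a'∉F++P ∘ ∈-++⁺ˡ , a'≢a , a≁a'
                , inj₂ b , b∈B' , b∉F++P ∘ ∈-++⁺ˡ , eab , ea'b)
      where
      b∈B' : S' v u (inj₂ b)
      b∈B' = neighbour∈B' eab (b∉F++P ∘ ∈-++⁺ʳ F)
      a'∈A' : S' v u (inj₁ a')
      a'∈A' = second-neighbour∈A' eab b∈B' ea'b (a'∉F++P ∘ ∈-++⁺ʳ F)
    isolated (_      , _ , _ , _ , _ , inj₁ _ , _ , _ , () , _)
    isolated (inj₂ _ , _ , _ , _ , _ , inj₂ _ , _ , _ , _ , ())

lemma3p3 : (E : ℕ → ℕ → Set) (rk : ℕ → ℕ) (v u : ℕ → ℕ) →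
    IsDHp E → OrderTypeω rk → IsDoubleRay E v u → IsEconomical E rk v u →
    (∀ a → ¬ PseudoIsolated E AllV (inj₁ a)) →
    ∀ a → S' v u (inj₁ a) → ¬ PseudoIsolated E (S' v u) (inj₁ a)
lemma3p3 E rk v u _ (rk-injective , _) ray economical no-pseudo-isolated a a∈A' pseudo-isolated =
  ¬¬-preimage-<-bounded (proj₁ ray ∘ rk-injective) (suc (rk a)) λ (N , below⇒<N) →
    no-pseudo-isolated a (pseudo-isolated-in-G'⇒G N a∈A' below⇒<N pseudo-isolated)
  where open EconomicalRay ray economical
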